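{- For all positive integers $n$ and $k$ there is a relational structure $\mathbf{S}=(S,R_{\mathbf{S}})$ with a single relation $R_{\mathbf{S}}$ of arity $2n$ and with vertex set $S=S_1\cup S_2\cup\dots\cup S_n$, the sets $S_i$ pairwise disjoint, such that: (1) for every $(v_1,u_1,v_2,u_2,\dots,v_n,u_n)\in R_{\mathbf{S}}$ we have $v_i,u_i\in S_i$ for all $1\le i\le n$, and every vertex appears in this tuple at most once; (2) any two distinct tuples of $R_{\mathbf{S}}$ have at most one common vertex; (3) for every coloring of $S$ with $2^k$ colors there is a tuple $(v_1,u_1,\dots,v_n,u_n)\in R_{\mathbf{S}}$ such that $v_i$ and $u_i$ have the same color for every $1\le i\le n$; (4) every vertex of $S$ is contained in at least one tuple of $R_{\mathbf{S}}$. -}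

module Defs where

open import Data.Nat using (ℕ)
open import Data.Fin using (Fin)
open import Data.Bool using (Bool; true; false)
open import Data.Product using (_×_; proj₁; proj₂; ∃)
open import Relation.Binary.PropositionalEquality using (_≡_)
open import Relation.Nullary using (¬_)

-- A tuple of arity 2n over the vertex set Fin m, written as
-- (v₁,u₁,v₂,u₂,…,vₙ,uₙ): position i ∈ Fin n carries the pair (vᵢ , uᵢ).
Tuple : ℕ → ℕ → Set
Tuple n m = Fin n → Fin m × Fin m

entry : ∀ {n m} → Tuple n m → Fin n → Bool → Fin m
entry t i false = proj₁ (t i)
entry t i true  = proj₂ (t i)

_∈ₜ_ : ∀ {n m} → Fin m → Tuple n m → Set
x ∈ₜ t = ∃ λ i → ∃ λ b → entry t i b ≡ x

AllDistinct : ∀ {n m} → Tuple n m → Set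
AllDistinct {n} t = ∀ (i j : Fin n) (b b′ : Bool) →
  entry t i b ≡ entry t j b′ → (i ≡ j) × (b ≡ b′)

SameTuple : ∀ {n m} → Tuple n m → Tuple n m → Set
SameTuple {n} t t′ = ∀ (i : Fin n) → t i ≡ t′ i

-- a relational structure on Fin m with one 2n-ary relation R and a partition
-- S = S₁ ∪ … ∪ Sₙ given by part : Fin m → Fin n (Sᵢ = part ⁻¹ {i}),
-- satisfying (1)–(4) for colorings with c colors
GoodStructure : (n c m : ℕ) → (Fin m → Fin n) → (Tuple n m → Set) → Set
GoodStructure n c m part R =
  (∀ t → R t → (∀ i → (part (entry t i false) ≡ i) × (part (entry t i true) ≡ i))
               × AllDistinct t)
  × (∀ t t′ → R t → R t′ → ¬ SameTuple t t′ →
       ∀ x y → x ∈ₜ t → x ∈ₜ t′ → y ∈ₜ t → y ∈ₜ t′ → x ≡ y)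
  × (∀ (col : Fin m → Fin c) → ∃ λ t → R t ×
       (∀ i → col (entry t i false) ≡ col (entry t i true)))
  × (∀ (x : Fin m) → ∃ λ t → R t × x ∈ₜ t)

-- Induction on the number n of parts, for an arbitrary number c of colours;
-- for n = 0 a single empty tuple suffices. Given a structure S with r tuples,
-- put N = 1 + c ^ r and take N² disjoint copies of S, indexed by pairs (y , d)
-- of levels, together with a new part whose vertices are pairs (z , e) of a
-- level z < 2N and a tuple e of S. The copy (y , d) of e is extended by the new
-- pair ((y , e) , (y + d + 1 , e)). Given a colouring, the N colour vectors
-- e ↦ colour (y , e) cannot all be distinct, so two levels i < j carry the same
-- vector; in the copy (i , j − i − 1) the induction hypothesis yields a tuple e
-- whose old pairs are monochromatic, and the new pair ((i , e) , (j , e)) is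
-- monochromatic too. Linearity survives because two distinct pairs of levels
-- y < y + d + 1 share at most one level.
module Submission where

open import Defs
open import Data.Bool using (Bool; true; false)
open import Data.Empty using (⊥; ⊥-elim)
open import Data.Fin as Fin
  using (Fin; zero; suc; toℕ; _↑ˡ_; _↑ʳ_; splitAt; fromℕ; fromℕ<; funToFin; finToFun)
open import Data.Fin.Properties
  using (toℕ<n; toℕ-injective; toℕ-↑ˡ; toℕ-↑ʳ; toℕ-fromℕ; toℕ-fromℕ<; ↑ˡ-injective;
         splitAt⁻¹-↑ˡ; splitAt⁻¹-↑ʳ; <-asym; <⇒≢; pigeonhole; finToFun-funToFin;
         0↔⊥; 1↔⊤; +↔⊎; *↔×)
open import Data.Nat using (ℕ; zero; suc; z<s; _≤_; _^_; _+_; _*_; _∸_)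
open import Data.Nat.Properties
  using (+-mono-≤; m<m+n; +-cancelˡ-≡; suc-injective; +-suc; +-comm; m+[n∸m]≡n; m∸n≤m;
         ≤-<-trans; n<1+n; module ≤-Reasoning)
open import Data.Product using (Σ; ∃; ∃₂; _×_; _,_; proj₁; proj₂; map)
open import Data.Product.Function.NonDependent.Propositional using (_×-↔_)
open import Data.Product.Properties using (,-injectiveˡ; ,-injectiveʳ)
open import Data.Sum using (_⊎_; inj₁; inj₂)
open import Data.Sum.Function.Propositional using (_⊎-↔_)
open import Data.Sum.Properties using (inj₁-injective; inj₂-injective)
open import Data.Unit using (⊤; tt)
open import Function using (_∘_; _↔_; Inverse; Injection)
open import Function.Properties.Inverse using (↔-refl; ↔-sym; ↔-trans; ↔⇒↣)
open import Level using (Level)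
open import Relation.Binary.Core using (Rel)
open import Relation.Binary.Definitions using (Asymmetric)
open import Relation.Binary.PropositionalEquality
open import Relation.Nullary using (¬_)

Finite : Set → Set
Finite A = Σ ℕ λ m → A ↔ Fin m

Fin-finite : ∀ m → Finite (Fin m)
Fin-finite m = m , ↔-refl

⊎-finite : ∀ {A B} → Finite A → Finite B → Finite (A ⊎ B)
⊎-finite (a , α) (b , β) = a + b , ↔-trans (α ⊎-↔ β) (↔-sym +↔⊎)

×-finite : ∀ {A B} → Finite A → Finite B → Finite (A × B)
×-finite (a , α) (b , β) = a * b , ↔-trans (α ×-↔ β) (↔-sym *↔×)

pigeonhole-functions : ∀ {A : Set} {c r} → A ↔ Fin r → (f : Fin (suc (c ^ r)) → A → Fin c) →
                       ∃₂ λ i j → i Fin.< j × (∀ a → f i a ≡ f j a)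
pigeonhole-functions {c = c} {r} ι f = agree (pigeonhole (n<1+n (c ^ r)) code)
  where
  open Inverse ι
  code : Fin (suc (c ^ r)) → Fin (c ^ r)
  code y = funToFin (f y ∘ from)
  decode : ∀ y a → finToFun (code y) (to a) ≡ f y a
  decode y a = trans (finToFun-funToFin (f y ∘ from) (to a)) (cong (f y) (strictlyInverseʳ a))
  agree : (∃₂ λ i j → i Fin.< j × code i ≡ code j) → ∃₂ λ i j → i Fin.< j × (∀ a → f i a ≡ f j a)
  agree (i , j , i<j , same) =
    i , j , i<j , λ a → trans (sym (decode i a)) (trans (cong (λ k → finToFun k (to a)) same) (decode j a))

at : {A : Set} → A × A → Bool → A
at x false = proj₁ x
at x true  = proj₂ x

at-map : ∀ {A B : Set} (f : A → B) x b → at (map f f x) b ≡ f (at x b)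
at-map f x false = refl
at-map f x true  = refl

_∈_ : {A : Set} {n : ℕ} → A → (Fin n → A × A) → Set
x ∈ t = ∃₂ λ i b → at (t i) b ≡ x

module _ {A : Set} {ℓ : Level} {_<_ : Rel A ℓ} (asym : Asymmetric _<_) where

  increasing-pairs-meet-once : ∀ {x x′ : A × A} {b₁ b₁′ b₂ b₂′} →
    proj₁ x < proj₂ x → proj₁ x′ < proj₂ x′ →
    at x b₁ ≡ at x′ b₁′ → at x b₂ ≡ at x′ b₂′ → b₁ ≡ b₂ ⊎ x ≡ x′
  increasing-pairs-meet-once {b₁ = false} {b₂ = false} _ _ _ _ = inj₁ refl
  increasing-pairs-meet-once {b₁ = true}  {b₂ = true}  _ _ _ _ = inj₁ refl
  increasing-pairs-meet-once {b₁ = false} {false} {true} {true}  x< x′< refl refl = inj₂ refl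
  increasing-pairs-meet-once {b₁ = false} {true}  {true} {false} x< x′< refl refl = ⊥-elim (asym x< x′<)
  increasing-pairs-meet-once {b₁ = false} {false} {true} {false} x< x′< refl refl = ⊥-elim (asym x< x<)
  increasing-pairs-meet-once {b₁ = false} {true}  {true} {true}  x< x′< refl refl = ⊥-elim (asym x< x<)
  increasing-pairs-meet-once {b₁ = true}  {true}  {false} {false} x< x′< refl refl = inj₂ refl
  increasing-pairs-meet-once {b₁ = true}  {false} {false} {true}  x< x′< refl refl = ⊥-elim (asym x< x′<)
  increasing-pairs-meet-once {b₁ = true}  {false} {false} {false} x< x′< refl refl = ⊥-elim (asym x< x<)
  increasing-pairs-meet-once {b₁ = true}  {true}  {false} {true}  x< x′< refl refl = ⊥-elim (asym x< x<)

module Levels (K : ℕ) where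

  N : ℕ
  N = suc K

  upper : Fin N → Fin N → Fin (N + N)
  upper y d = fromℕ< {toℕ y + suc (toℕ d)} (+-mono-≤ (toℕ<n y) (toℕ<n d))

  toℕ-upper : ∀ y d → toℕ (upper y d) ≡ toℕ y + suc (toℕ d)
  toℕ-upper y d = toℕ-fromℕ< _

  upper-injective : ∀ y {d d′} → upper y d ≡ upper y d′ → d ≡ d′
  upper-injective y {d} {d′} eq =
    toℕ-injective (suc-injective (+-cancelˡ-≡ (toℕ y) _ _ (begin
      toℕ y + suc (toℕ d)   ≡⟨ toℕ-upper y d ⟨
      toℕ (upper y d)       ≡⟨ cong toℕ eq ⟩
      toℕ (upper y d′)      ≡⟨ toℕ-upper y d′ ⟩
      toℕ y + suc (toℕ d′)  ∎)))
    where open ≡-Reasoning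

  upper-last : ∀ y → upper y (fromℕ K) ≡ N ↑ʳ y
  upper-last y = toℕ-injective (begin
    toℕ (upper y (fromℕ K))      ≡⟨ toℕ-upper y (fromℕ K) ⟩
    toℕ y + suc (toℕ (fromℕ K))  ≡⟨ cong (λ k → toℕ y + suc k) (toℕ-fromℕ K) ⟩
    toℕ y + N                    ≡⟨ +-comm (toℕ y) N ⟩
    N + toℕ y                    ≡⟨ toℕ-↑ʳ N y ⟨
    toℕ (N ↑ʳ y)                 ∎)
    where open ≡-Reasoning

  upper-reaches : ∀ {i j} → i Fin.< j → ∃ λ d → upper i d ≡ j ↑ˡ N
  upper-reaches {i} {j} i<j = d , toℕ-injective (begin
    toℕ (upper i d)                      ≡⟨ toℕ-upper i d ⟩
    toℕ i + suc (toℕ d)                  ≡⟨ cong (λ k → toℕ i + suc k) (toℕ-fromℕ< _) ⟩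
    toℕ i + suc (toℕ j ∸ suc (toℕ i))    ≡⟨ +-suc (toℕ i) _ ⟩
    suc (toℕ i) + (toℕ j ∸ suc (toℕ i))  ≡⟨ m+[n∸m]≡n i<j ⟩
    toℕ j                                ≡⟨ toℕ-↑ˡ j N ⟨
    toℕ (j ↑ˡ N)                         ∎)
    where
    open ≡-Reasoning
    d : Fin N
    d = fromℕ< (≤-<-trans (m∸n≤m (toℕ j) (suc (toℕ i))) (toℕ<n j))

  span : Fin N × Fin N → Fin (N + N) × Fin (N + N)
  span (y , d) = y ↑ˡ N , upper y d

  span-increasing : ∀ p → proj₁ (span p) Fin.< proj₂ (span p)
  span-increasing (y , d) = begin-strict
    toℕ (y ↑ˡ N)          ≡⟨ toℕ-↑ˡ y N ⟩
    toℕ y                 <⟨ m<m+n (toℕ y) z<s ⟩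
    toℕ y + suc (toℕ d)   ≡⟨ toℕ-upper y d ⟨
    toℕ (upper y d)       ∎
    where open ≤-Reasoning

  span-injective : ∀ {p p′} → span p ≡ span p′ → p ≡ p′
  span-injective {y , d} {y′ , d′} eq with ↑ˡ-injective N y y′ (,-injectiveˡ eq)
  ... | refl = cong (y ,_) (upper-injective y (,-injectiveʳ eq))

  span-covers : ∀ z → ∃₂ λ p b → at (span p) b ≡ z
  span-covers z with splitAt N z in eq
  ... | inj₁ y = (y , zero) , false , splitAt⁻¹-↑ˡ eq
  ... | inj₂ y = (y , fromℕ K) , true , trans (upper-last y) (splitAt⁻¹-↑ʳ eq)

record PartiteRamseyStructure (n c : ℕ) : Set₁ where
  field
    Vertex Edge         : Set
    Vertex-finite       : Finite Vertex
    Edge-finite         : Finite Edge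
    part                : Vertex → Fin n
    tuple               : Edge → Fin n → Vertex × Vertex
    tuple-partite       : ∀ e i b → part (at (tuple e i) b) ≡ i
    tuple-nondegenerate : ∀ e i → proj₁ (tuple e i) ≢ proj₂ (tuple e i)
    linear              : ∀ {e e′} → e ≢ e′ → ∀ {x y} →
                          x ∈ tuple e → x ∈ tuple e′ → y ∈ tuple e → y ∈ tuple e′ → x ≡ y
    ramsey              : ∀ (colour : Vertex → Fin c) →
                          ∃ λ e → ∀ i → colour (proj₁ (tuple e i)) ≡ colour (proj₂ (tuple e i))
    covering            : ∀ x → ∃ λ e → x ∈ tuple e

empty-structure : ∀ c → PartiteRamseyStructure 0 c
empty-structure c = record
  { Vertex = ⊥ ; Edge = ⊤
  ; Vertex-finite = 0 , ↔-sym 0↔⊥ ; Edge-finite = 1 , ↔-sym 1↔⊤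
  ; part = λ () ; tuple = λ _ ()
  ; tuple-partite = λ _ () ; tuple-nondegenerate = λ _ ()
  ; linear = λ { {tt} {tt} tt≢tt → ⊥-elim (tt≢tt refl) }
  ; ramsey = λ _ → tt , λ ()
  ; covering = λ ()
  }

module Extension {n c : ℕ} (S : PartiteRamseyStructure n c) where

  open PartiteRamseyStructure S
  open Levels (c ^ proj₁ Edge-finite)

  -- The copy (y , d) stands for the pair of levels y < y + d + 1; indexing by
  -- (y , d) instead of by such pairs keeps the index set a plain product.
  Copy : Set
  Copy = Fin N × Fin N

  Vertex′ : Set
  Vertex′ = (Copy × Vertex) ⊎ (Fin (N + N) × Edge)

  Edge′ : Set
  Edge′ = Copy × Edge

  copy : Copy → Vertex → Vertex′
  copy p v = inj₁ (p , v)

  level : Edge → Fin (N + N) → Vertex′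
  level e z = inj₂ (z , e)

  part′ : Vertex′ → Fin (suc n)
  part′ (inj₁ (_ , v)) = suc (part v)
  part′ (inj₂ _)       = zero

  tuple′ : Edge′ → Fin (suc n) → Vertex′ × Vertex′
  tuple′ (p , e) zero    = map (level e) (level e) (span p)
  tuple′ (p , e) (suc i) = map (copy p) (copy p) (tuple e i)

  tuple′-partite : ∀ e i b → part′ (at (tuple′ e i) b) ≡ i
  tuple′-partite (p , e) zero    false = refl
  tuple′-partite (p , e) zero    true  = refl
  tuple′-partite (p , e) (suc i) false = cong suc (tuple-partite e i false)
  tuple′-partite (p , e) (suc i) true  = cong suc (tuple-partite e i true)

  tuple′-nondegenerate : ∀ e i → proj₁ (tuple′ e i) ≢ proj₂ (tuple′ e i)
  tuple′-nondegenerate (p , e) zero eq =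
    <⇒≢ (span-increasing p) (,-injectiveˡ (inj₂-injective eq))
  tuple′-nondegenerate (p , e) (suc i) eq =
    tuple-nondegenerate e i (,-injectiveʳ (inj₁-injective eq))

  copy-∈ : ∀ {p q e v} → copy q v ∈ tuple′ (p , e) → q ≡ p × v ∈ tuple e
  copy-∈ (suc i , false , refl) = refl , i , false , refl
  copy-∈ (suc i , true  , refl) = refl , i , true  , refl

  level-∈ : ∀ {p e a z} → level a z ∈ tuple′ (p , e) → a ≡ e × ∃ λ b → at (span p) b ≡ z
  level-∈ (zero , false , refl) = refl , false , refl
  level-∈ (zero , true  , refl) = refl , true  , refl

  linear′ : ∀ {f f′} → f ≢ f′ → ∀ {x y} →
            x ∈ tuple′ f → x ∈ tuple′ f′ → y ∈ tuple′ f → y ∈ tuple′ f′ → x ≡ y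
  linear′ {p , _} f≢f′ {inj₁ _} {inj₁ _} x∈ x∈′ y∈ y∈′
    with copy-∈ x∈ | copy-∈ x∈′ | copy-∈ y∈ | copy-∈ y∈′
  ... | refl , v∈ | refl , v∈′ | refl , w∈ | _ , w∈′ =
    cong (copy p) (linear (λ e≡e′ → f≢f′ (cong (p ,_) e≡e′)) v∈ v∈′ w∈ w∈′)
  linear′ f≢f′ {inj₁ _} {inj₂ _} x∈ x∈′ y∈ y∈′
    with copy-∈ x∈ | copy-∈ x∈′ | level-∈ y∈ | level-∈ y∈′
  ... | refl , _ | refl , _ | refl , _ | refl , _ = ⊥-elim (f≢f′ refl)
  linear′ f≢f′ {inj₂ _} {inj₁ _} x∈ x∈′ y∈ y∈′
    with level-∈ x∈ | level-∈ x∈′ | copy-∈ y∈ | copy-∈ y∈′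
  ... | refl , _ | refl , _ | refl , _ | refl , _ = ⊥-elim (f≢f′ refl)
  linear′ {p , e} {p′ , _} f≢f′ {inj₂ _} {inj₂ _} x∈ x∈′ y∈ y∈′
    with level-∈ x∈ | level-∈ x∈′ | level-∈ y∈ | level-∈ y∈′
  ... | refl , b₁ , refl | refl , b₁′ , z≡ | refl , b₂ , refl | _ , b₂′ , z′≡
    with increasing-pairs-meet-once {_<_ = Fin._<_} <-asym {span p} {span p′} {b₁} {b₁′} {b₂} {b₂′}
             (span-increasing p) (span-increasing p′) (sym z≡) (sym z′≡)
  ... | inj₁ refl = refl
  ... | inj₂ same = ⊥-elim (f≢f′ (cong (_, e) (span-injective same)))

  ramsey′ : ∀ (colour : Vertex′ → Fin c) →
            ∃ λ f → ∀ i → colour (proj₁ (tuple′ f i)) ≡ colour (proj₂ (tuple′ f i))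
  ramsey′ colour
    with i , j , i<j , same ← pigeonhole-functions (proj₂ Edge-finite) (λ y e → colour (level e (y ↑ˡ N)))
    with d , upper≡ ← upper-reaches i<j
    with e , monochromatic ← ramsey (colour ∘ copy (i , d))
    = ((i , d) , e) , λ where
      zero    → trans (same e) (cong (colour ∘ level e) (sym upper≡))
      (suc k) → monochromatic k

  covering′ : ∀ x → ∃ λ f → x ∈ tuple′ f
  covering′ (inj₁ (p , v)) with e , i , b , refl ← covering v =
    (p , e) , suc i , b , at-map (copy p) (tuple e i) b
  covering′ (inj₂ (z , e)) with p , b , refl ← span-covers z =
    (p , e) , zero , b , at-map (level e) (span p) b

  structure : PartiteRamseyStructure (suc n) c
  structure = record
    { Vertex = Vertex′ ; Edge = Edge′
    ; Vertex-finite = ⊎-finite (×-finite (×-finite (Fin-finite N) (Fin-finite N)) Vertex-finite)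
                               (×-finite (Fin-finite (N + N)) Edge-finite)
    ; Edge-finite = ×-finite (×-finite (Fin-finite N) (Fin-finite N)) Edge-finite
    ; part = part′ ; tuple = tuple′
    ; tuple-partite = tuple′-partite ; tuple-nondegenerate = tuple′-nondegenerate
    ; linear = linear′ ; ramsey = ramsey′ ; covering = covering′
    }

partite-nondegenerate⇒AllDistinct : ∀ {n m} (part : Fin m → Fin n) (t : Tuple n m) →
  (∀ i b → part (entry t i b) ≡ i) → (∀ i → proj₁ (t i) ≢ proj₂ (t i)) → AllDistinct t
partite-nondegenerate⇒AllDistinct part t partite nondegenerate i j b b′ eq
  with trans (sym (partite i b)) (trans (cong part eq) (partite j b′))
... | refl = refl , same-side b b′ eq
  where
  same-side : ∀ b b′ → entry t i b ≡ entry t i b′ → b ≡ b′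
  same-side false false _  = refl
  same-side true  true  _  = refl
  same-side false true  eq = ⊥-elim (nondegenerate i eq)
  same-side true  false eq = ⊥-elim (nondegenerate i (sym eq))

good-structure : ∀ {n c} → PartiteRamseyStructure n c →
  ∃ λ (m : ℕ) → Σ (Fin m → Fin n) λ part → Σ (Tuple n m → Set) λ R → GoodStructure n c m part R
good-structure {n} {c} S =
  m , part ∘ from , R , partite , linearᶠ , ramseyᶠ , coveringᶠ
  where
  open PartiteRamseyStructure S
  m : ℕ
  m = proj₁ Vertex-finite
  open Inverse (proj₂ Vertex-finite)

  to-injective : ∀ {v w} → to v ≡ to w → v ≡ w
  to-injective = Injection.injective (↔⇒↣ (proj₂ Vertex-finite))

  from-injective : ∀ {x y} → from x ≡ from y → x ≡ y
  from-injective = Injection.injective (↔⇒↣ (↔-sym (proj₂ Vertex-finite)))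

  tupleᶠ : Edge → Tuple n m
  tupleᶠ e i = map to to (tuple e i)

  R : Tuple n m → Set
  R t = ∃ λ e → tupleᶠ e ≡ t

  entry-tupleᶠ : ∀ e i b → entry (tupleᶠ e) i b ≡ to (at (tuple e i) b)
  entry-tupleᶠ e i false = refl
  entry-tupleᶠ e i true  = refl

  partᶠ : ∀ e i b → part (from (entry (tupleᶠ e) i b)) ≡ i
  partᶠ e i b = begin
    part (from (entry (tupleᶠ e) i b))   ≡⟨ cong (part ∘ from) (entry-tupleᶠ e i b) ⟩
    part (from (to (at (tuple e i) b)))  ≡⟨ cong part (strictlyInverseʳ _) ⟩
    part (at (tuple e i) b)              ≡⟨ tuple-partite e i b ⟩
    i                                    ∎
    where open ≡-Reasoning

  ∈ᶠ⇒∈ : ∀ {e x} → x ∈ₜ tupleᶠ e → from x ∈ tuple e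
  ∈ᶠ⇒∈ {e} (i , b , refl) =
    i , b , sym (trans (cong from (entry-tupleᶠ e i b)) (strictlyInverseʳ _))

  partite : ∀ t → R t → (∀ i → (part (from (entry t i false)) ≡ i) × (part (from (entry t i true)) ≡ i))
                        × AllDistinct t
  partite _ (e , refl) =
    (λ i → partᶠ e i false , partᶠ e i true) ,
    partite-nondegenerate⇒AllDistinct (part ∘ from) (tupleᶠ e) (partᶠ e)
      (λ i → tuple-nondegenerate e i ∘ to-injective)

  linearᶠ : ∀ t t′ → R t → R t′ → ¬ SameTuple t t′ →
            ∀ x y → x ∈ₜ t → x ∈ₜ t′ → y ∈ₜ t → y ∈ₜ t′ → x ≡ y
  linearᶠ _ _ (e , refl) (e′ , refl) distinct x y x∈ x∈′ y∈ y∈′ =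
    from-injective (linear e≢e′ (∈ᶠ⇒∈ x∈) (∈ᶠ⇒∈ x∈′) (∈ᶠ⇒∈ y∈) (∈ᶠ⇒∈ y∈′))
    where
    e≢e′ : e ≢ e′
    e≢e′ refl = distinct λ _ → refl

  ramseyᶠ : ∀ (colour : Fin m → Fin c) →
            ∃ λ t → R t × (∀ i → colour (entry t i false) ≡ colour (entry t i true))
  ramseyᶠ colour with e , monochromatic ← ramsey (colour ∘ to) = tupleᶠ e , (e , refl) , monochromatic

  coveringᶠ : ∀ x → ∃ λ t → R t × x ∈ₜ t
  coveringᶠ x with e , i , b , v≡ ← covering (from x) =
    tupleᶠ e , (e , refl) , i , b ,
    trans (entry-tupleᶠ e i b) (trans (cong to v≡) (strictlyInverseˡ x))

construction : ∀ n c → PartiteRamseyStructure n c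
construction zero    c = empty-structure c
construction (suc n) c = Extension.structure (construction n c)

lemma2 : ∀ (n k : ℕ) → 1 ≤ n → 1 ≤ k →
    ∃ λ (m : ℕ) → Σ (Fin m → Fin n) λ part → Σ (Tuple n m → Set) λ R →
      GoodStructure n (2 ^ k) m part R
lemma2 n k _ _ = good-structure (construction n (2 ^ k))
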